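{- Let $A_k=\{a_1,\dots,a_k\}$ with $1=a_1<a_2<\dots<a_k$ integers, let $h_0$ be the smallest positive integer $h$ with $n(h)\ge a_k$, and let $h\ge h_0$ be an integer. If $x$ is an $h$-gap and $x_h=c_ka_k+c_{k-1}a_{k-1}+\dots+c_1a_1$ with nonnegative integers $c_i$ and $\sum_i c_i\le h$, then $c_k=0$.
   Context: For an integer $h\ge 0$, an integer $y\ge 0$ has an $h$-representation if $y=\sum_{i=1}^k c_ia_i$ with nonnegative integers $c_i$ and $\sum_i c_i\le h$. The $h$-range $n(h)$ is the largest integer $n$ such that every integer $0\le y\le n$ has an $h$-representation. For an integer $x$ and integer $h$, put $x_h=x+(h-(h_0-1))a_k$. For an integer $m\ge h_0$, an integer $x>n(h_0-1)$ is called an $m$-gap if $x_h$ has no $h$-representation for every integer $h$ with $h_0-1\le h<m$, but $x_m$ has an $m$-representation. -}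

module Defs where

open import Data.Nat using (ℕ; zero; suc; _+_; _*_; _∸_; _≤_; _<_)
open import Data.Fin using (Fin; zero; suc; fromℕ; toℕ)
open import Data.Product using (Σ; _×_)
open import Relation.Binary.PropositionalEquality using (_≡_)
open import Relation.Nullary using (¬_)

∑ : ∀ {n} → (Fin n → ℕ) → ℕ
∑ {zero}  f = 0
∑ {suc n} f = f zero + ∑ (λ i → f (suc i))

-- The set A_k = {a_1,…,a_k} with k = suc m is given by a : Fin (suc m) → ℕ,
-- where a zero = a_1 and a (fromℕ m) = a_k.
-- Admissible: 1 = a_1 < a_2 < … < a_k.
Admissible : ∀ {m} → (Fin (suc m) → ℕ) → Set
Admissible a = (a zero ≡ 1) × (∀ (i j : Fin _) → toℕ i < toℕ j → a i < a j)

top : ∀ {m} → (Fin (suc m) → ℕ) → ℕ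
top {m} a = a (fromℕ m)

HasRep : ∀ {m} → (Fin (suc m) → ℕ) → ℕ → ℕ → Set
HasRep a h y = Σ (Fin _ → ℕ) λ c → (∑ c ≤ h) × (y ≡ ∑ (λ i → c i * a i))

AllRepUpTo : ∀ {m} → (Fin (suc m) → ℕ) → ℕ → ℕ → Set
AllRepUpTo a h n = ∀ y → y ≤ n → HasRep a h y

IsRange : ∀ {m} → (Fin (suc m) → ℕ) → ℕ → ℕ → Set
IsRange a h n = AllRepUpTo a h n × (∀ n' → AllRepUpTo a h n' → n' ≤ n)

IsH0 : ∀ {m} → (Fin (suc m) → ℕ) → ℕ → Set
IsH0 a h₀ =
  (1 ≤ h₀)
  × (∀ N → IsRange a h₀ N → top a ≤ N)
  × (∀ h → 1 ≤ h → h < h₀ → ∀ N → IsRange a h N → N < top a)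

-- x_h = x + (h - (h₀ - 1)) a_k   (only used for h ≥ h₀ - 1)
xsub : ∀ {m} → (Fin (suc m) → ℕ) → ℕ → ℕ → ℕ → ℕ
xsub a h₀ x h = x + (h ∸ (h₀ ∸ 1)) * top a

IsGap : ∀ {m} → (Fin (suc m) → ℕ) → ℕ → ℕ → ℕ → Set
IsGap a h₀ m' x =
  (h₀ ≤ m')
  × (∀ N → IsRange a (h₀ ∸ 1) N → N < x)
  × (∀ h → h₀ ∸ 1 ≤ h → h < m' → ¬ HasRep a h (xsub a h₀ x h))
  × HasRep a m' (xsub a h₀ x m')

module Submission where

-- Idea: suppose c_k ≥ 1.  Removing one copy of a_k from the representation
-- gives a representation of x_h − a_k with at most h − 1 summands.  Since
-- x_h = x_{h−1} + a_k, this is an (h−1)-representation of x_{h−1}.  But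
-- h₀ − 1 ≤ h − 1 < h, so the gap condition says x_{h−1} has no
-- (h−1)-representation, a contradiction.

open import Defs
open import Data.Nat using (ℕ; suc; zero; pred; _*_; _+_; _∸_; _≤_; s≤s)
open import Data.Nat.Properties
  using (*-identityʳ; +-assoc; +-∸-assoc; +-cancelˡ-≡; ≤-pred; ≤-refl;
         +-commutativeSemigroup)
open import Algebra.Properties.CommutativeSemigroup +-commutativeSemigroup
  using (x∙yz≈y∙xz)
open import Data.Fin using (Fin; fromℕ; zero; suc)
open import Data.Vec.Functional using (updateAt)
open import Data.Product using (_,_)
open import Data.Empty using (⊥-elim)
open import Relation.Binary.PropositionalEquality
  using (_≡_; refl; sym; trans; cong; cong₂; subst; module ≡-Reasoning)
open ≡-Reasoning

∑-cong : ∀ {n} (f g : Fin n → ℕ) → (∀ i → f i ≡ g i) → ∑ f ≡ ∑ g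
∑-cong {zero}  f g f≗g = refl
∑-cong {suc n} f g f≗g =
  cong₂ _+_ (f≗g zero) (∑-cong (λ i → f (suc i)) (λ i → g (suc i)) (λ i → f≗g (suc i)))

∑-remove-one : ∀ {n t} (c w : Fin n → ℕ) (j : Fin n) → c j ≡ suc t →
               ∑ (λ i → c i * w i) ≡ w j + ∑ (λ i → updateAt c j pred i * w i)
∑-remove-one {suc n} c w zero cⱼ≡1+t rewrite cⱼ≡1+t =
  +-assoc (w zero) _ (∑ (λ i → c (suc i) * w (suc i)))
∑-remove-one {suc n} c w (suc j) cⱼ≡1+t = begin
  c zero * w zero + ∑ (λ i → c (suc i) * w (suc i))
    ≡⟨ cong (c zero * w zero +_)
         (∑-remove-one (λ i → c (suc i)) (λ i → w (suc i)) j cⱼ≡1+t) ⟩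
  c zero * w zero + (w (suc j) + rest)
    ≡⟨ x∙yz≈y∙xz (c zero * w zero) (w (suc j)) rest ⟩
  w (suc j) + (c zero * w zero + rest)
    ∎
  where rest = ∑ (λ i → updateAt (λ i → c (suc i)) j pred i * w (suc i))

∑-count-remove-one : ∀ {n t} (c : Fin n → ℕ) (j : Fin n) → c j ≡ suc t →
                     ∑ c ≡ suc (∑ (updateAt c j pred))
∑-count-remove-one c j cⱼ≡1+t = begin
  ∑ c                                             ≡⟨ ∑-cong c _ (λ i → sym (*-identityʳ (c i))) ⟩
  ∑ (λ i → c i * 1)                               ≡⟨ ∑-remove-one c (λ _ → 1) j cⱼ≡1+t ⟩
  suc (∑ (λ i → updateAt c j pred i * 1))         ≡⟨ cong suc (∑-cong _ (updateAt c j pred) (λ i → *-identityʳ _)) ⟩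
  suc (∑ (updateAt c j pred))                     ∎

representation-without : ∀ {m t h y} (a : Fin (suc m) → ℕ) (j : Fin (suc m))
  (c : Fin (suc m) → ℕ) → c j ≡ suc t → ∑ c ≤ suc h →
  a j + y ≡ ∑ (λ i → c i * a i) → HasRep a h y
representation-without {h = h} a j c cⱼ≡1+t Σc≤1+h aⱼ+y≡Σca =
  updateAt c j pred
  , ≤-pred (subst (_≤ suc h) (∑-count-remove-one c j cⱼ≡1+t) Σc≤1+h)
  , +-cancelˡ-≡ (a j) _ _ (trans aⱼ+y≡Σca (∑-remove-one c a j cⱼ≡1+t))

xsub-suc : ∀ {m} (a : Fin (suc m) → ℕ) {d h} (x : ℕ) → d ≤ h →
           xsub a (suc d) x (suc h) ≡ top a + xsub a (suc d) x h
xsub-suc a {d} {h} x d≤h = begin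
  x + (suc h ∸ d) * top a                  ≡⟨ cong (λ e → x + e * top a) (+-∸-assoc 1 d≤h) ⟩
  x + (top a + (h ∸ d) * top a)            ≡⟨ x∙yz≈y∙xz x (top a) _ ⟩
  top a + (x + (h ∸ d) * top a)            ∎

lemma2 : (m : ℕ) (a : Fin (suc m) → ℕ) → Admissible a →
    (h₀ : ℕ) → IsH0 a h₀ →
    (h : ℕ) → h₀ ≤ h →
    (x : ℕ) → IsGap a h₀ h x →
    (c : Fin (suc m) → ℕ) → ∑ c ≤ h →
    xsub a h₀ x h ≡ ∑ (λ i → c i * a i) →
    c (fromℕ m) ≡ 0
lemma2 m a _ zero (() , _) h _ x _ c _ _
lemma2 m a _ (suc d) _ zero () x _ c _ _
lemma2 m a _ (suc d) _ (suc h) (s≤s d≤h) x (_ , _ , noRepBelow , _) c Σc≤h xₕ≡Σca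
  with c (fromℕ m) in cₖ≡
... | zero  = refl
... | suc t = ⊥-elim (noRepBelow h d≤h ≤-refl repOfPrevious)
  where
  repOfPrevious : HasRep a h (xsub a (suc d) x h)
  repOfPrevious = representation-without a (fromℕ m) c cₖ≡ Σc≤h
                    (trans (sym (xsub-suc a x d≤h)) xₕ≡Σca)
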